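{- There is no online algorithm for the coloured bin packing problem that is an $(\alpha,\beta)$-approximation algorithm with $\alpha$ and $\beta$ constants.
   Context: Coloured bin packing: an instance $I$ is a finite set of items, each item $e$ having a size $s(e)\in(0,1]$ and a colour $c(e)\in\{1,\dots,m\}$; items are packed into unit-capacity bins. $I_c$ is the set of items of colour $c$; $\mathrm{OPT}(I)$ and $\mathrm{OPT}(I_c)$ are the minimum numbers of bins needed to pack $I$ and $I_c$ (computed offline, with full knowledge of $I$). For a packing $P$, $P(I)$ is the number of bins used and $P_c(I)$ the number of bins containing at least one item of colour $c$. An algorithm is an $(\alpha,\beta)$-approximation algorithm if on every instance its packing satisfies $P(I)\le\alpha\,\mathrm{OPT}(I)+O(1)$ and $P_c(I)\le\beta\,\mathrm{OPT}(I_c)+O(1)$ for every colour $c$, with additive constants independent of the instance. In the online setting, items arrive one at a time and each must be irrevocably assigned to a bin upon arrival, without knowledge of future items. -}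

module Defs where

open import Data.Nat as ℕ using (ℕ; _<_; _≟_)
open import Data.Rational as ℚ using (ℚ; 0ℚ; 1ℚ)
open import Data.List using (List; []; _∷_; _++_; [_]; length; filter; deduplicate)
open import Data.List.Relation.Unary.All using (All)
open import Data.Product using (Σ; ∃; _×_)
open import Relation.Binary.PropositionalEquality using (_≡_)
open import Relation.Nullary using (¬_; yes; no)

record Item : Set where
  constructor item
  field
    size   : ℚ
    colour : ℕ
open Item public

ValidItem : Item → Set
ValidItem e = (0ℚ ℚ.< size e) × (size e ℚ.≤ 1ℚ)

-- An instance is a finite sequence of valid items (arrival order for the online setting).
Instance : Set
Instance = List Item

ValidInstance : Instance → Set
ValidInstance σ = All ValidItem σ

-- Load of bin b: total size of the items whose assigned bin (same position in the
-- assignment list) is b.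
load : List Item → List ℕ → ℕ → ℚ
load (e ∷ es) (a ∷ as) b with a ≟ b
... | yes _ = size e ℚ.+ load es as b
... | no  _ = load es as b
load _ _ _ = 0ℚ

Feasible : List Item → List ℕ → Set
Feasible L as = length as ≡ length L × (∀ b → load L as b ℚ.≤ 1ℚ)

Packable : List Item → ℕ → Set
Packable L k = Σ (List ℕ) λ as → Feasible L as × All (_< k) as

IsOPT : List Item → ℕ → Set
IsOPT L k = Packable L k × (∀ j → Packable L j → k ℕ.≤ j)

colourClass : ℕ → List Item → List Item
colourClass c = filter (λ e → colour e ≟ c)

-- A deterministic online algorithm: given the items that arrived so far (in order)
-- and the current item, it irrevocably chooses a bin index for the current item.
-- (Its earlier decisions are determined by the earlier history, so they are
-- recomputable and need not be passed separately.)
OnlineAlg : Set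
OnlineAlg = List Item → Item → ℕ

runFrom : OnlineAlg → List Item → List Item → List ℕ
runFrom A hist []       = []
runFrom A hist (e ∷ es) = A hist e ∷ runFrom A (hist ++ [ e ]) es

run : OnlineAlg → Instance → List ℕ
run A σ = runFrom A [] σ

CorrectAlg : OnlineAlg → Set
CorrectAlg A = ∀ σ → ValidInstance σ → Feasible σ (run A σ)

#bins : List ℕ → ℕ
#bins as = length (deduplicate _≟_ as)

binsOfColour : ℕ → List Item → List ℕ → List ℕ
binsOfColour c (e ∷ es) (a ∷ as) with colour e ≟ c
... | yes _ = a ∷ binsOfColour c es as
... | no  _ = binsOfColour c es as
binsOfColour c _ _ = []

P : OnlineAlg → Instance → ℕ
P A σ = #bins (run A σ)

Pc : OnlineAlg → ℕ → Instance → ℕ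
Pc A c σ = #bins (binsOfColour c σ (run A σ))

IsApprox : OnlineAlg → ℕ → ℕ → ℕ → Set
IsApprox A α β d =
  ∀ σ → ValidInstance σ →
    (∀ k → IsOPT σ k → P A σ ℕ.≤ α ℕ.* k ℕ.+ d) ×
    (∀ c k → IsOPT (colourClass c σ) k → Pc A c σ ℕ.≤ β ℕ.* k ℕ.+ d)

module Submission where

-- Adversary argument.  Suppose A is an (α,β)-approximation with additive
-- constant d and put K = β + d.  All items have the same size 1/Q, so a bin
-- holds at most Q items, and a colour class with at most Q items has OPT = 1.
-- Initially the Q colours 0, …, Q-1 are "active".  In stage j every active
-- colour receives a block of Δ_j items; it stays active only if A puts one of
-- them into a bin that was not used before the stage.  A colour that drops
-- out fills old bins with Δ_j items, and there are at most α·OPT + d old bins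
-- with room for Q items each; Δ_j is so large that at most Q/T colours (with
-- T = K + 2) drop out per stage.  Hence after K + 1 stages some colour is
-- still active: it occupies K + 1 distinct bins although its class has OPT = 1,
-- contradicting P_c ≤ β·1 + d = K.

open import Defs
open import Data.Nat using (ℕ)
open import Data.Product using (∃)
open import Relation.Nullary using (¬_)

open import Level using (0ℓ)
open import Data.Nat using (zero; suc; _+_; _*_; _∸_; _≤_; _<_; z≤n; s≤s; z<s; _≟_; _≤?_; _<?_; NonZero; >-nonZero; >-nonZero⁻¹)
open import Data.Nat.Properties
open import Data.Rational as ℚ using (ℚ; 0ℚ; 1ℚ)
import Data.Rational.Properties as ℚP
open import Data.List using (List; []; _∷_; _++_; length; replicate; take; drop; filter; deduplicate; downFrom)
import Data.List.Properties as LP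
open import Data.List.Relation.Unary.All as All using (All; []; _∷_; all?)
import Data.List.Relation.Unary.All.Properties as AllP
open import Data.List.Relation.Unary.Any as Any using (here; there)
import Data.List.Relation.Unary.Any.Properties as AnyP
open import Data.List.Membership.Propositional using (_∈_; _∉_; find)
open import Data.List.Membership.Propositional.Properties using (∈-filter⁺; ∈-deduplicate⁺)
open import Data.List.Membership.DecPropositional _≟_ using (_∈?_)
open import Data.List.Relation.Binary.Subset.Propositional using (_⊆_)
open import Data.List.Relation.Unary.Unique.Propositional using (Unique)
open import Data.List.Relation.Unary.AllPairs using ([]; _∷_)
open import Data.Product as Product using (_×_; _,_; proj₁; proj₂)
open import Relation.Nullary using (yes; no; ¬?; contradiction)
open import Relation.Nullary.Negation using (¬¬-Monad; ¬¬-map)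
open import Relation.Nullary.Decidable using (¬¬-excluded-middle)
open import Relation.Binary.PropositionalEquality
open import Effect.Monad using (RawMonad)
open RawMonad (¬¬-Monad {a = 0ℓ}) using (pure; _>>=_)

packable-mono : ∀ {L j k} → j ≤ k → Packable L j → Packable L k
packable-mono j≤k (as , feasible , in-range) =
  as , feasible , All.map (λ a<j → <-≤-trans a<j j≤k) in-range

-- If L fits into k bins, then OPT(L) exists and is at most k.  Packability is
-- not decided, so the minimum is only obtained under double negation.
¬¬-optimum : ∀ L k → Packable L k → ¬ ¬ (∃ λ o → IsOPT L o × o ≤ k)
¬¬-optimum L zero fits = pure (zero , (fits , λ _ _ → z≤n) , z≤n)
¬¬-optimum L (suc k) fits = ¬¬-excluded-middle >>= λ where
    (yes fits-k) → ¬¬-map weaken (¬¬-optimum L k fits-k)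
    (no ¬fits-k) → pure (suc k , (fits , lower-bound ¬fits-k) , ≤-refl)
  where
  weaken : (∃ λ o → IsOPT L o × o ≤ k) → ∃ λ o → IsOPT L o × o ≤ suc k
  weaken (o , opt , o≤k) = o , opt , m≤n⇒m≤1+n o≤k

  lower-bound : ¬ Packable L k → ∀ j → Packable L j → k < j
  lower-bound ¬fits-k j fits-j with k <? j
  ... | yes k<j = k<j
  ... | no k≮j = contradiction (packable-mono {L} (≮⇒≥ k≮j) fits-j) ¬fits-k

module Guarantee (A : OnlineAlg) (α β d : ℕ) (approx : IsApprox A α β d) where

  total-bins-bound : ∀ σ → ValidInstance σ → ∀ k → Packable σ k → ¬ ¬ (P A σ ≤ α * k + d)
  total-bins-bound σ valid k fits = ¬¬-map bound (¬¬-optimum σ k fits)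
    where
    bound : (∃ λ o → IsOPT σ o × o ≤ k) → P A σ ≤ α * k + d
    bound (o , opt , o≤k) =
      ≤-trans (proj₁ (approx σ valid) o opt) (+-monoˡ-≤ d (*-monoʳ-≤ α o≤k))

  colour-bins-bound : ∀ σ → ValidInstance σ → ∀ c k → Packable (colourClass c σ) k →
                      ¬ ¬ (Pc A c σ ≤ β * k + d)
  colour-bins-bound σ valid c k fits = ¬¬-map bound (¬¬-optimum (colourClass c σ) k fits)
    where
    bound : (∃ λ o → IsOPT (colourClass c σ) o × o ≤ k) → Pc A c σ ≤ β * k + d
    bound (o , opt , o≤k) =
      ≤-trans (proj₂ (approx σ valid) c o opt) (+-monoˡ-≤ d (*-monoʳ-≤ β o≤k))

occ : ℕ → List ℕ → ℕ
occ b [] = 0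
occ b (a ∷ as) with a ≟ b
... | yes _ = suc (occ b as)
... | no  _ = occ b as

occ-++ : ∀ b xs ys → occ b (xs ++ ys) ≡ occ b xs + occ b ys
occ-++ b [] ys = refl
occ-++ b (a ∷ xs) ys with a ≟ b
... | yes _ = cong suc (occ-++ b xs ys)
... | no  _ = occ-++ b xs ys

occ-take : ∀ b n xs → occ b (take n xs) ≤ occ b xs
occ-take b zero xs = z≤n
occ-take b (suc n) [] = z≤n
occ-take b (suc n) (a ∷ xs) with a ≟ b
... | yes _ = s≤s (occ-take b n xs)
... | no  _ = occ-take b n xs

occ-replicate : ∀ b n a → occ b (replicate n a) ≤ n
occ-replicate b zero a = z≤n
occ-replicate b (suc n) a with a ≟ b
... | yes _ = s≤s (occ-replicate b n a)
... | no  _ = m≤n⇒m≤1+n (occ-replicate b n a)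

occ-absent : ∀ b xs → All (λ a → a ≢ b) xs → occ b xs ≡ 0
occ-absent b [] [] = refl
occ-absent b (a ∷ xs) (a≢b ∷ rest) with a ≟ b
... | yes a≡b = contradiction a≡b a≢b
... | no  _ = occ-absent b xs rest

occ-downFrom : ∀ b n → occ b (downFrom n) ≤ 1
occ-downFrom b zero = z≤n
occ-downFrom b (suc n) with n ≟ b
... | no  _ = occ-downFrom b n
... | yes refl = s≤s (≤-reflexive (occ-absent n (downFrom n) smaller))
  where
  smaller : All (λ a → a ≢ n) (downFrom n)
  smaller = AllP.applyDownFrom⁺₁ (λ i → i) n <⇒≢

fill : ℕ → ℕ → List ℕ
fill Q zero = []
fill Q (suc k) = replicate Q k ++ fill Q k

fill-length : ∀ Q k → length (fill Q k) ≡ k * Q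
fill-length Q zero = refl
fill-length Q (suc k) =
  trans (LP.length-++ (replicate Q k)) (cong₂ _+_ (LP.length-replicate Q) (fill-length Q k))

fill-range : ∀ Q k → All (_< k) (fill Q k)
fill-range Q zero = []
fill-range Q (suc k) =
  AllP.++⁺ (AllP.replicate⁺ Q ≤-refl) (All.map m≤n⇒m≤1+n (fill-range Q k))

fill-occ : ∀ Q k b → occ b (fill Q k) ≤ Q
fill-occ Q zero b = z≤n
fill-occ Q (suc k) b rewrite occ-++ b (replicate Q k) (fill Q k) with k ≟ b
... | yes refl rewrite occ-absent k (fill Q k) (All.map <⇒≢ (fill-range Q k)) =
  ≤-trans (≤-reflexive (+-identityʳ _)) (occ-replicate k Q k)
... | no k≢b rewrite occ-absent b (replicate Q k) (AllP.replicate⁺ Q k≢b) = fill-occ Q k b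

-- n · x = x + ⋯ + x (n summands): the load of a bin holding n items of size x.
infix 7 _·_
_·_ : ℕ → ℚ → ℚ
zero · x = 0ℚ
suc n · x = x ℚ.+ n · x

load-uniform : ∀ x L as b → All (λ e → size e ≡ x) L → length as ≡ length L →
               load L as b ≡ occ b as · x
load-uniform x [] [] b [] _ = refl
load-uniform x (e ∷ L) (a ∷ as) b (size≡x ∷ rest) len with a ≟ b
... | yes _ = cong₂ ℚ._+_ size≡x (load-uniform x L as b rest (suc-injective len))
... | no  _ = load-uniform x L as b rest (suc-injective len)

·-scales : ∀ n x → n · x ≡ (n · 1ℚ) ℚ.* x
·-scales zero x = sym (ℚP.*-zeroˡ x)
·-scales (suc n) x = begin
  x ℚ.+ n · x                       ≡⟨ cong₂ ℚ._+_ (sym (ℚP.*-identityˡ x)) (·-scales n x) ⟩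
  1ℚ ℚ.* x ℚ.+ (n · 1ℚ) ℚ.* x       ≡⟨ sym (ℚP.*-distribʳ-+ x 1ℚ (n · 1ℚ)) ⟩
  (1ℚ ℚ.+ n · 1ℚ) ℚ.* x             ∎
  where open ≡-Reasoning

·-mono : ∀ {x} → 0ℚ ℚ.≤ x → ∀ {m n} → m ≤ n → m · x ℚ.≤ n · x
·-mono {x} 0≤x {zero} {zero} _ = ℚP.≤-refl
·-mono {x} 0≤x {zero} {suc n} _ =
  ℚP.≤-trans (·-mono 0≤x {zero} {n} z≤n)
             (subst (ℚ._≤ x ℚ.+ n · x) (ℚP.+-identityˡ (n · x)) (ℚP.+-monoˡ-≤ (n · x) 0≤x))
·-mono {x} 0≤x {suc m} {suc n} (s≤s m≤n) = ℚP.+-monoʳ-≤ x (·-mono 0≤x m≤n)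

·1-positive : ∀ n → {{NonZero n}} → 0ℚ ℚ.< n · 1ℚ
·1-positive (suc n) =
  subst (ℚ._< 1ℚ ℚ.+ n · 1ℚ) (ℚP.+-identityˡ 0ℚ)
        (ℚP.+-mono-<-≤ (ℚP.positive⁻¹ 1ℚ) (·-mono (ℚP.<⇒≤ (ℚP.positive⁻¹ 1ℚ)) {zero} {n} z≤n))

module UnitSize (Q : ℕ) {{_ : NonZero Q}} where

  instance
    Q·1-positive : ℚ.Positive (Q · 1ℚ)
    Q·1-positive = ℚ.positive (·1-positive Q)

    Q·1-nonZero : ℚ.NonZero (Q · 1ℚ)
    Q·1-nonZero = ℚP.pos⇒nonZero (Q · 1ℚ)

  unit : ℚ
  unit = ℚ.1/ (Q · 1ℚ)

  unit-positive : 0ℚ ℚ.< unit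
  unit-positive = ℚP.positive⁻¹ unit {{ℚP.1/pos⇒pos (Q · 1ℚ)}}

  unit-nonneg : 0ℚ ℚ.≤ unit
  unit-nonneg = ℚP.<⇒≤ unit-positive

  Q·unit≡1 : Q · unit ≡ 1ℚ
  Q·unit≡1 = trans (·-scales Q unit) (ℚP.*-inverseʳ (Q · 1ℚ))

  ≤Q⇒fits : ∀ {n} → n ≤ Q → n · unit ℚ.≤ 1ℚ
  ≤Q⇒fits n≤Q = ℚP.≤-trans (·-mono unit-nonneg n≤Q) (ℚP.≤-reflexive Q·unit≡1)

  fits⇒≤Q : ∀ n → n · unit ℚ.≤ 1ℚ → n ≤ Q
  fits⇒≤Q n fits with n ≤? Q
  ... | yes n≤Q = n≤Q
  ... | no  n≰Q = contradiction (ℚP.<-≤-trans overfull (ℚP.≤-trans (·-mono unit-nonneg (≰⇒> n≰Q)) fits))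
                                (ℚP.<-irrefl refl)
    where
    overfull : 1ℚ ℚ.< suc Q · unit
    overfull = subst₂ ℚ._<_ (ℚP.+-identityˡ 1ℚ) (cong (unit ℚ.+_) (sym Q·unit≡1))
                      (ℚP.+-monoˡ-< 1ℚ unit-positive)

  Uniform : List Item → Set
  Uniform L = All (λ e → size e ≡ unit) L

  uniform⇒valid : ∀ {L} → Uniform L → ValidInstance L
  uniform⇒valid = All.map λ size≡unit →
    subst (0ℚ ℚ.<_) (sym size≡unit) unit-positive ,
    subst (ℚ._≤ 1ℚ) (sym size≡unit) unit≤1
    where
    unit≤1 : unit ℚ.≤ 1ℚ
    unit≤1 = subst (ℚ._≤ 1ℚ) (ℚP.+-identityʳ unit) (≤Q⇒fits (>-nonZero⁻¹ Q))

  capacity : ∀ {L as} → Uniform L → Feasible L as → ∀ b → occ b as ≤ Q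
  capacity {L} {as} uniform (len , loads) b =
    fits⇒≤Q _ (subst (ℚ._≤ 1ℚ) (load-uniform unit L as b uniform len) (loads b))

  uniform-packable : ∀ {L k} → Uniform L → length L ≤ k * Q → Packable L k
  uniform-packable {L} {k} uniform short =
    as , (len , λ b → subst (ℚ._≤ 1ℚ) (sym (load-uniform unit L as b uniform len))
                             (≤Q⇒fits (≤-trans (occ-take b (length L) (fill Q k)) (fill-occ Q k b)))) ,
    AllP.take⁺ (length L) (fill-range Q k)
    where
    as : List ℕ
    as = take (length L) (fill Q k)
    len : length as ≡ length L
    len = trans (LP.length-take (length L) (fill Q k))
                (m≤n⇒m⊓n≡m (subst (length L ≤_) (sym (fill-length Q k)) short))

runFrom-++ : ∀ A h xs ys → runFrom A h (xs ++ ys) ≡ runFrom A h xs ++ runFrom A (h ++ xs) ys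
runFrom-++ A h [] ys = cong (λ h′ → runFrom A h′ ys) (sym (LP.++-identityʳ h))
runFrom-++ A h (x ∷ xs) ys =
  cong (A h x ∷_) (trans (runFrom-++ A (h ++ (x ∷ [])) xs ys)
                         (cong (λ h′ → runFrom A (h ++ (x ∷ [])) xs ++ runFrom A h′ ys)
                               (LP.++-assoc h (x ∷ []) xs)))

runFrom-length : ∀ A h xs → length (runFrom A h xs) ≡ length xs
runFrom-length A h [] = refl
runFrom-length A h (x ∷ xs) = cong suc (runFrom-length A (h ++ (x ∷ [])) xs)

binsOfColour-++ : ∀ c σ τ as bs → length as ≡ length σ →
  binsOfColour c (σ ++ τ) (as ++ bs) ≡ binsOfColour c σ as ++ binsOfColour c τ bs
binsOfColour-++ c [] τ [] bs _ = refl
binsOfColour-++ c (e ∷ σ) τ (a ∷ as) bs len with colour e ≟ c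
... | yes _ = cong (a ∷_) (binsOfColour-++ c σ τ as bs (suc-injective len))
... | no  _ = binsOfColour-++ c σ τ as bs (suc-injective len)

binsOfColour-⊆ : ∀ c σ as → binsOfColour c σ as ⊆ as
binsOfColour-⊆ c (e ∷ σ) (a ∷ as) b∈ with colour e ≟ c
binsOfColour-⊆ c (e ∷ σ) (a ∷ as) (here b≡a) | yes _ = here b≡a
binsOfColour-⊆ c (e ∷ σ) (a ∷ as) (there b∈) | yes _ = there (binsOfColour-⊆ c σ as b∈)
binsOfColour-⊆ c (e ∷ σ) (a ∷ as) b∈         | no  _ = there (binsOfColour-⊆ c σ as b∈)

binsOfColour-monochrome : ∀ c σ as → All (λ e → colour e ≡ c) σ → length as ≡ length σ →
  binsOfColour c σ as ≡ as
binsOfColour-monochrome c [] [] [] _ = refl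
binsOfColour-monochrome c (e ∷ σ) (a ∷ as) (colour≡c ∷ rest) len with colour e ≟ c
... | yes _ = cong (a ∷_) (binsOfColour-monochrome c σ as rest (suc-injective len))
... | no  colour≢c = contradiction colour≡c colour≢c

colourClass-length-++ : ∀ c σ τ →
  length (colourClass c (σ ++ τ)) ≡ length (colourClass c σ) + length (colourClass c τ)
colourClass-length-++ c σ τ =
  trans (cong length (LP.filter-++ (λ e → colour e ≟ c) σ τ)) (LP.length-++ (colourClass c σ))

unique-⊆-length : ∀ {W V : List ℕ} → Unique W → W ⊆ V → length W ≤ length V
unique-⊆-length {[]} _ _ = z≤n
unique-⊆-length {w ∷ W} {V} (w∉W ∷ unique) W⊆V = begin-strict
  length W                   ≤⟨ unique-⊆-length unique W⊆V-w ⟩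
  length (filter other V)    <⟨ LP.filter-notAll other V w∈V ⟩
  length V                   ∎
  where
  open ≤-Reasoning
  other = λ v → ¬? (v ≟ w)
  W⊆V-w : W ⊆ filter other V
  W⊆V-w x∈W = ∈-filter⁺ other (W⊆V (there x∈W)) (λ x≡w → All.lookup w∉W x∈W (sym x≡w))
  w∈V = Any.map (λ w≡v v≢w → v≢w (sym w≡v)) (W⊆V (here refl))

hits : List ℕ → List ℕ → ℕ
hits U [] = 0
hits U (x ∷ xs) with x ∈? U
... | yes _ = suc (hits U xs)
... | no  _ = hits U xs

hits-++ : ∀ U xs ys → hits U (xs ++ ys) ≡ hits U xs + hits U ys
hits-++ U [] ys = refl
hits-++ U (x ∷ xs) ys with x ∈? U
... | yes _ = cong suc (hits-++ U xs ys)
... | no  _ = hits-++ U xs ys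

hits-take-drop : ∀ U n xs → hits U (take n xs) + hits U (drop n xs) ≡ hits U xs
hits-take-drop U n xs = trans (sym (hits-++ U (take n xs) (drop n xs))) (cong (hits U) (LP.take++drop≡id n xs))

hits-all : ∀ U xs → All (_∈ U) xs → hits U xs ≡ length xs
hits-all U [] [] = refl
hits-all U (x ∷ xs) (x∈U ∷ rest) with x ∈? U
... | yes _ = cong suc (hits-all U xs rest)
... | no x∉U = contradiction x∈U x∉U

hits-∷ : ∀ v U xs → hits (v ∷ U) xs ≤ occ v xs + hits U xs
hits-∷ v U [] = z≤n
hits-∷ v U (x ∷ xs) with x ≟ v | x ∈? U
... | yes _ | yes _ = s≤s (≤-trans (hits-∷ v U xs) (+-monoʳ-≤ (occ v xs) (n≤1+n _)))
... | yes _ | no  _ = s≤s (hits-∷ v U xs)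
... | no  _ | yes _ = ≤-trans (s≤s (hits-∷ v U xs)) (≤-reflexive (sym (+-suc _ _)))
... | no  _ | no  _ = hits-∷ v U xs

hits-bound : ∀ Q U xs → (∀ b → occ b xs ≤ Q) → hits U xs ≤ length U * Q
hits-bound Q [] xs _ = ≤-reflexive (no-hits xs)
  where
  no-hits : ∀ xs → hits [] xs ≡ 0
  no-hits [] = refl
  no-hits (x ∷ xs) = no-hits xs
hits-bound Q (v ∷ U) xs bounded =
  ≤-trans (hits-∷ v U xs) (+-mono-≤ (bounded v) (hits-bound Q U xs bounded))

take-length : ∀ Δ n (bs : List ℕ) → length bs ≡ Δ + n → length (take Δ bs) ≡ Δ
take-length Δ n bs len =
  trans (LP.length-take Δ bs) (m≤n⇒m⊓n≡m (subst (Δ ≤_) (sym len) (m≤m+n Δ n)))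

drop-length : ∀ Δ n (bs : List ℕ) → length bs ≡ Δ + n → length (drop Δ bs) ≡ n
drop-length Δ n bs len = trans (LP.length-drop Δ bs) (trans (cong (_∸ Δ) len) (m+n∸m≡n Δ n))

-- In a stage, U are the bins used so far, S the active colours, and bs the bins
-- chosen for the new items, Δ consecutive entries (a chunk) per colour of S.
survivors : List ℕ → ℕ → List ℕ → List ℕ → List ℕ
survivors U Δ [] bs = []
survivors U Δ (c ∷ S) bs with all? (_∈? U) (take Δ bs)
... | yes _ = survivors U Δ S (drop Δ bs)
... | no  _ = c ∷ survivors U Δ S (drop Δ bs)

dropouts : List ℕ → ℕ → List ℕ → List ℕ → ℕ
dropouts U Δ [] bs = 0
dropouts U Δ (c ∷ S) bs with all? (_∈? U) (take Δ bs)
... | yes _ = suc (dropouts U Δ S (drop Δ bs))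
... | no  _ = dropouts U Δ S (drop Δ bs)

survivors+dropouts : ∀ U Δ S bs → length S ≡ length (survivors U Δ S bs) + dropouts U Δ S bs
survivors+dropouts U Δ [] bs = refl
survivors+dropouts U Δ (c ∷ S) bs with all? (_∈? U) (take Δ bs)
... | yes _ = trans (cong suc (survivors+dropouts U Δ S (drop Δ bs))) (sym (+-suc _ _))
... | no  _ = cong suc (survivors+dropouts U Δ S (drop Δ bs))

occ-survivors : ∀ c U Δ S bs → occ c (survivors U Δ S bs) ≤ occ c S
occ-survivors c U Δ [] bs = z≤n
occ-survivors c U Δ (a ∷ S) bs with all? (_∈? U) (take Δ bs)
... | yes _ with a ≟ c
...   | yes _ = m≤n⇒m≤1+n (occ-survivors c U Δ S (drop Δ bs))
...   | no  _ = occ-survivors c U Δ S (drop Δ bs)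
occ-survivors c U Δ (a ∷ S) bs | no _ with a ≟ c
...   | yes _ = s≤s (occ-survivors c U Δ S (drop Δ bs))
...   | no  _ = occ-survivors c U Δ S (drop Δ bs)

dropouts-hits : ∀ U Δ S bs → length bs ≡ length S * Δ → dropouts U Δ S bs * Δ ≤ hits U bs
dropouts-hits U Δ [] bs len = z≤n
dropouts-hits U Δ (c ∷ S) bs len with all? (_∈? U) (take Δ bs)
... | yes chunk⊆U = begin
  Δ + dropouts U Δ S (drop Δ bs) * Δ
    ≡⟨ cong (_+ dropouts U Δ S (drop Δ bs) * Δ) (sym (trans (hits-all U (take Δ bs) chunk⊆U) (take-length Δ _ bs len))) ⟩
  hits U (take Δ bs) + dropouts U Δ S (drop Δ bs) * Δ
    ≤⟨ +-monoʳ-≤ (hits U (take Δ bs)) rest ⟩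
  hits U (take Δ bs) + hits U (drop Δ bs)
    ≡⟨ hits-take-drop U Δ bs ⟩
  hits U bs ∎
  where
  open ≤-Reasoning
  rest = dropouts-hits U Δ S (drop Δ bs) (drop-length Δ _ bs len)
... | no  _ = ≤-trans (dropouts-hits U Δ S (drop Δ bs) (drop-length Δ _ bs len))
                      (≤-trans (m≤n+m _ (hits U (take Δ bs))) (≤-reflexive (hits-take-drop U Δ bs)))

module Blocks (x : ℚ) where

  block : ℕ → List ℕ → List Item
  block Δ [] = []
  block Δ (c ∷ S) = replicate Δ (item x c) ++ block Δ S

  block-length : ∀ Δ S → length (block Δ S) ≡ length S * Δ
  block-length Δ [] = refl
  block-length Δ (c ∷ S) =
    trans (LP.length-++ (replicate Δ (item x c)))
          (cong₂ _+_ (LP.length-replicate Δ) (block-length Δ S))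

  block-size : ∀ Δ S → All (λ e → size e ≡ x) (block Δ S)
  block-size Δ [] = []
  block-size Δ (c ∷ S) = AllP.++⁺ (AllP.replicate⁺ Δ refl) (block-size Δ S)

  colourClass-block : ∀ c Δ S → length (colourClass c (block Δ S)) ≡ occ c S * Δ
  colourClass-block c Δ [] = refl
  colourClass-block c Δ (a ∷ S) with a ≟ c
  ... | yes refl = trans (colourClass-length-++ c (replicate Δ (item x c)) (block Δ S))
    (cong₂ _+_ (trans (cong length (LP.filter-all (λ e → colour e ≟ c) (AllP.replicate⁺ Δ refl)))
                      (LP.length-replicate Δ))
               (colourClass-block c Δ S))
  ... | no a≢c = trans (colourClass-length-++ c (replicate Δ (item x a)) (block Δ S))
    (cong₂ _+_ (cong length (LP.filter-none (λ e → colour e ≟ c) (AllP.replicate⁺ Δ a≢c)))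
               (colourClass-block c Δ S))

  binsOfColour-block : ∀ c a Δ S bs → length bs ≡ length (a ∷ S) * Δ →
    binsOfColour c (block Δ (a ∷ S)) bs ≡
    binsOfColour c (replicate Δ (item x a)) (take Δ bs) ++ binsOfColour c (block Δ S) (drop Δ bs)
  binsOfColour-block c a Δ S bs len =
    trans (cong (binsOfColour c (block Δ (a ∷ S))) (sym (LP.take++drop≡id Δ bs)))
          (binsOfColour-++ c (replicate Δ (item x a)) (block Δ S) (take Δ bs) (drop Δ bs)
                           (trans (take-length Δ _ bs len) (sym (LP.length-replicate Δ))))

  NewBin : List ℕ → ℕ → Instance → List ℕ → Set
  NewBin U c σ as = ∃ λ b → b ∉ U × b ∈ binsOfColour c σ as

  new-bin-first : ∀ {U a Δ S bs} → length bs ≡ length (a ∷ S) * Δ →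
    ¬ All (_∈ U) (take Δ bs) → NewBin U a (block Δ (a ∷ S)) bs
  new-bin-first {U} {a} {Δ} {S} {bs} len chunk⊈U
    with b , b∈chunk , b∉U ← find (AllP.¬All⇒Any¬ (_∈? U) (take Δ bs) chunk⊈U) =
    b , b∉U , subst (b ∈_) (sym (binsOfColour-block a a Δ S bs len))
                    (AnyP.++⁺ˡ (subst (b ∈_) (sym chunk-is-a) b∈chunk))
    where
    chunk-is-a : binsOfColour a (replicate Δ (item x a)) (take Δ bs) ≡ take Δ bs
    chunk-is-a = binsOfColour-monochrome a (replicate Δ (item x a)) (take Δ bs) (AllP.replicate⁺ Δ refl)
                   (trans (take-length Δ _ bs len) (sym (LP.length-replicate Δ)))

  new-bin-later : ∀ {U c a Δ S bs} → length bs ≡ length (a ∷ S) * Δ →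
    NewBin U c (block Δ S) (drop Δ bs) → NewBin U c (block Δ (a ∷ S)) bs
  new-bin-later {U} {c} {a} {Δ} {S} {bs} len (b , b∉U , b∈) =
    b , b∉U , subst (b ∈_) (sym (binsOfColour-block c a Δ S bs len)) (AnyP.++⁺ʳ _ b∈)

  survivor-new-bin : ∀ {U c Δ S bs} → length bs ≡ length S * Δ →
    c ∈ survivors U Δ S bs → c ∈ S × NewBin U c (block Δ S) bs
  survivor-new-bin {U} {c} {Δ} {a ∷ S} {bs} len c∈ with all? (_∈? U) (take Δ bs)
  survivor-new-bin {U} {c} {Δ} {a ∷ S} {bs} len c∈         | yes _ =
    Product.map there (new-bin-later {U} {c} {a} {Δ} {S} {bs} len)
                (survivor-new-bin {U} {c} {Δ} {S} {drop Δ bs} (drop-length Δ _ bs len) c∈)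
  survivor-new-bin {U} {c} {Δ} {a ∷ S} {bs} len (here refl) | no chunk⊈U =
    here refl , new-bin-first {U} {c} {Δ} {S} {bs} len chunk⊈U
  survivor-new-bin {U} {c} {Δ} {a ∷ S} {bs} len (there c∈)  | no _ =
    Product.map there (new-bin-later {U} {c} {a} {Δ} {S} {bs} len)
                (survivor-new-bin {U} {c} {Δ} {S} {drop Δ bs} (drop-length Δ _ bs len) c∈)

module Adversary (A : OnlineAlg) (correct : CorrectAlg A) (α β d : ℕ)
                 (approx : IsApprox A α β d) where

  -- A colour meeting K + 1 bins violates the colour guarantee when its OPT is 1.
  K : ℕ
  K = β + d

  -- At most Q / T colours drop out per stage, and T > K + 1.
  T : ℕ
  T = suc (suc K)

  -- m j bounds OPT(σ j) and the size of every colour class of σ j;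
  -- Δ j is the number of items each active colour receives in stage j.
  m Δ : ℕ → ℕ
  Δ j = suc (T * (α * m j + d))
  m zero = 0
  m (suc j) = m j + Δ j

  -- Items have size 1/Q, so every colour class of the final instance fits in one bin.
  Q : ℕ
  Q = m (suc K)

  instance
    Q-nonZero : NonZero Q
    Q-nonZero = >-nonZero (<-≤-trans z<s (m≤n+m (Δ K) (m K)))

  open Guarantee A α β d approx
  open UnitSize Q
  open Blocks unit

  -- σ j is the instance presented after j stages and S j the active colours;
  -- old-bins j are the bins used on σ j and new-bins j the bins of the next block.
  σ : ℕ → Instance
  S : ℕ → List ℕ
  old-bins new-bins : ℕ → List ℕ

  σ zero = []
  σ (suc j) = σ j ++ block (Δ j) (S j)

  S zero = downFrom Q
  S (suc j) = survivors (old-bins j) (Δ j) (S j) (new-bins j)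

  old-bins j = deduplicate _≟_ (run A (σ j))
  new-bins j = runFrom A (σ j) (block (Δ j) (S j))

  dropped : ℕ → ℕ
  dropped j = dropouts (old-bins j) (Δ j) (S j) (new-bins j)

  run-step : ∀ j → run A (σ (suc j)) ≡ run A (σ j) ++ new-bins j
  run-step j = runFrom-++ A [] (σ j) (block (Δ j) (S j))

  new-bins-length : ∀ j → length (new-bins j) ≡ length (S j) * Δ j
  new-bins-length j = trans (runFrom-length A (σ j) (block (Δ j) (S j))) (block-length (Δ j) (S j))

  uniform-σ : ∀ j → Uniform (σ j)
  uniform-σ zero = []
  uniform-σ (suc j) = AllP.++⁺ (uniform-σ j) (block-size (Δ j) (S j))

  valid-σ : ∀ j → ValidInstance (σ j)
  valid-σ j = uniform⇒valid (uniform-σ j)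

  active-distinct : ∀ j c → occ c (S j) ≤ 1
  active-distinct zero c = occ-downFrom c Q
  active-distinct (suc j) c =
    ≤-trans (occ-survivors c (old-bins j) (Δ j) (S j) (new-bins j)) (active-distinct j c)

  active-step : ∀ j → length (S j) ≡ length (S (suc j)) + dropped j
  active-step j = survivors+dropouts (old-bins j) (Δ j) (S j) (new-bins j)

  active-length : ∀ j → length (S j) ≤ Q
  active-length zero = ≤-reflexive (LP.length-downFrom Q)
  active-length (suc j) =
    ≤-trans (≤-trans (m≤m+n _ (dropped j)) (≤-reflexive (sym (active-step j)))) (active-length j)

  σ-length : ∀ j → length (σ j) ≤ m j * Q
  σ-length zero = z≤n
  σ-length (suc j) = begin
    length (σ j ++ block (Δ j) (S j))         ≡⟨ LP.length-++ (σ j) ⟩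
    length (σ j) + length (block (Δ j) (S j)) ≡⟨ cong (length (σ j) +_) (block-length (Δ j) (S j)) ⟩
    length (σ j) + length (S j) * Δ j         ≤⟨ +-mono-≤ (σ-length j) (*-monoˡ-≤ (Δ j) (active-length j)) ⟩
    m j * Q + Q * Δ j                         ≡⟨ cong (m j * Q +_) (*-comm Q (Δ j)) ⟩
    m j * Q + Δ j * Q                         ≡⟨ sym (*-distribʳ-+ Q (m j) (Δ j)) ⟩
    m (suc j) * Q                             ∎
    where open ≤-Reasoning

  σ-packable : ∀ j → Packable (σ j) (m j)
  σ-packable j = uniform-packable (uniform-σ j) (σ-length j)

  -- Every colour has at most m j items in σ j (active colours are distinct, so
  -- each receives at most one chunk per stage),
  -- so each colour class of the final instance fits into one bin.
  colour-count : ∀ j c → length (colourClass c (σ j)) ≤ m j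
  colour-count zero c = z≤n
  colour-count (suc j) c = begin
    length (colourClass c (σ j ++ block (Δ j) (S j)))
      ≡⟨ colourClass-length-++ c (σ j) (block (Δ j) (S j)) ⟩
    length (colourClass c (σ j)) + length (colourClass c (block (Δ j) (S j)))
      ≡⟨ cong (length (colourClass c (σ j)) +_) (colourClass-block c (Δ j) (S j)) ⟩
    length (colourClass c (σ j)) + occ c (S j) * Δ j
      ≤⟨ +-mono-≤ (colour-count j c) (*-monoˡ-≤ (Δ j) (active-distinct j c)) ⟩
    m j + 1 * Δ j
      ≡⟨ cong (m j +_) (*-identityˡ (Δ j)) ⟩
    m (suc j) ∎
    where open ≤-Reasoning

  class-fits-one-bin : ∀ c → Packable (colourClass c (σ (suc K))) 1
  class-fits-one-bin c =
    uniform-packable (AllP.filter⁺ (λ e → colour e ≟ c) (uniform-σ (suc K)))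
                     (≤-trans (colour-count (suc K) c) (≤-reflexive (sym (*-identityˡ Q))))

  -- If A uses at most α·m j + d bins on σ j, at most Q / T colours drop out:
  -- the dropped colours put all their Δ j items into these old bins, which
  -- hold at most Q items each, and Δ j > T·(α·m j + d).
  dropout-bound : ∀ j → P A (σ j) ≤ α * m j + d → T * dropped j ≤ Q
  dropout-bound j few-bins = *-cancelʳ-≤ (T * dropped j) Q (Δ j) (begin
    T * dropped j * Δ j          ≡⟨ *-assoc T (dropped j) (Δ j) ⟩
    T * (dropped j * Δ j)        ≤⟨ *-monoʳ-≤ T old-bins-filled ⟩
    T * ((α * m j + d) * Q)      ≡⟨ sym (*-assoc T (α * m j + d) Q) ⟩
    T * (α * m j + d) * Q        ≤⟨ *-monoˡ-≤ Q (n≤1+n (T * (α * m j + d))) ⟩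
    Δ j * Q                      ≡⟨ *-comm (Δ j) Q ⟩
    Q * Δ j                      ∎)
    where
    open ≤-Reasoning
    within-capacity : ∀ b → occ b (run A (σ j) ++ new-bins j) ≤ Q
    within-capacity b = subst (λ as → occ b as ≤ Q) (run-step j)
      (capacity (uniform-σ (suc j)) (correct (σ (suc j)) (valid-σ (suc j))) b)
    old-bins-filled : dropped j * Δ j ≤ (α * m j + d) * Q
    old-bins-filled = begin
      dropped j * Δ j
        ≤⟨ dropouts-hits (old-bins j) (Δ j) (S j) (new-bins j) (new-bins-length j) ⟩
      hits (old-bins j) (new-bins j)
        ≤⟨ m≤n+m _ _ ⟩
      hits (old-bins j) (run A (σ j)) + hits (old-bins j) (new-bins j)
        ≡⟨ sym (hits-++ (old-bins j) (run A (σ j)) (new-bins j)) ⟩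
      hits (old-bins j) (run A (σ j) ++ new-bins j)
        ≤⟨ hits-bound Q (old-bins j) (run A (σ j) ++ new-bins j) within-capacity ⟩
      P A (σ j) * Q
        ≤⟨ *-monoˡ-≤ Q few-bins ⟩
      (α * m j + d) * Q ∎

  active-count : ∀ j → ¬ ¬ (T * Q ≤ T * length (S j) + j * Q)
  active-count zero =
    pure (≤-reflexive (trans (cong (T *_) (sym (LP.length-downFrom Q))) (sym (+-identityʳ _))))
  active-count (suc j) = do
    before ← active-count j
    few-bins ← total-bins-bound (σ j) (valid-σ j) (m j) (σ-packable j)
    pure (begin
      T * Q                                            ≤⟨ before ⟩
      T * length (S j) + j * Q                         ≡⟨ cong (λ n → T * n + j * Q) (active-step j) ⟩
      T * (length (S (suc j)) + dropped j) + j * Q     ≡⟨ cong (_+ j * Q) (*-distribˡ-+ T (length (S (suc j))) (dropped j)) ⟩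
      T * length (S (suc j)) + T * dropped j + j * Q   ≤⟨ +-monoˡ-≤ (j * Q) (+-monoʳ-≤ (T * length (S (suc j))) (dropout-bound j few-bins)) ⟩
      T * length (S (suc j)) + Q + j * Q               ≡⟨ +-assoc (T * length (S (suc j))) Q (j * Q) ⟩
      T * length (S (suc j)) + suc j * Q               ∎)
    where open ≤-Reasoning

  -- Since T > K + 1, some colour is still active after K + 1 stages.
  some-active : ¬ ¬ (∃ λ c → c ∈ S (suc K))
  some-active = ¬¬-map (nonempty (S (suc K))) (active-count (suc K))
    where
    nonempty : ∀ L → T * Q ≤ T * length L + suc K * Q → ∃ λ c → c ∈ L
    nonempty (c ∷ _) _ = c , here refl
    nonempty [] bound = contradiction (subst (T * Q ≤_) (cong (_+ suc K * Q) (*-zeroʳ T)) bound)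
                                      (<⇒≱ (m<n+m (suc K * Q) (>-nonZero⁻¹ Q)))

  Spread : ℕ → ℕ → Set
  Spread j c = ∃ λ W → Unique W × length W ≡ j × W ⊆ binsOfColour c (σ j) (run A (σ j))

  colour-bins-step : ∀ j c → binsOfColour c (σ (suc j)) (run A (σ (suc j))) ≡
    binsOfColour c (σ j) (run A (σ j)) ++ binsOfColour c (block (Δ j) (S j)) (new-bins j)
  colour-bins-step j c = trans (cong (binsOfColour c (σ (suc j))) (run-step j))
    (binsOfColour-++ c (σ j) (block (Δ j) (S j)) (run A (σ j)) (new-bins j) (runFrom-length A [] (σ j)))

  -- An active colour gains a new, distinct bin in every stage.
  active-spread : ∀ j c → c ∈ S j → Spread j c
  active-spread zero c _ = [] , [] , refl , λ ()
  active-spread (suc j) c c∈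
    with survivor-new-bin {old-bins j} {c} {Δ j} {S j} {new-bins j} (new-bins-length j) c∈
  ... | c∈S , b , b∉old , b∈new with active-spread j c c∈S
  ... | W , unique , len , W⊆ = b ∷ W , fresh ∷ unique , cong suc len , W′⊆
    where
    fresh : All (b ≢_) W
    fresh = All.tabulate λ w∈W b≡w → b∉old (subst (_∈ old-bins j) (sym b≡w)
      (∈-deduplicate⁺ _≟_ (binsOfColour-⊆ c (σ j) (run A (σ j)) (W⊆ w∈W))))
    W′⊆ : b ∷ W ⊆ binsOfColour c (σ (suc j)) (run A (σ (suc j)))
    W′⊆ (here refl) = subst (b ∈_) (sym (colour-bins-step j c)) (AnyP.++⁺ʳ _ b∈new)
    W′⊆ (there w∈W) = subst (_ ∈_) (sym (colour-bins-step j c)) (AnyP.++⁺ˡ (W⊆ w∈W))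

  active-bins : ∀ j c → c ∈ S j → j ≤ Pc A c (σ j)
  active-bins j c c∈ with active-spread j c c∈
  ... | W , unique , refl , W⊆ = unique-⊆-length unique (λ w∈W → ∈-deduplicate⁺ _≟_ (W⊆ w∈W))

-- A surviving colour meets K + 1 bins, but its class fits into one bin, so the
-- colour guarantee allows only β·1 + d = K bins.
theorem4 : (A : OnlineAlg) → CorrectAlg A →
    (α β d : ℕ) → ¬ IsApprox A α β d
theorem4 A correct α β d approx =
  some-active λ (c , c∈S) →
  colour-bins-bound (σ (suc K)) (valid-σ (suc K)) c 1 (class-fits-one-bin c) λ Pc≤β·1+d →
  1+n≰n (begin
    suc K                    ≤⟨ active-bins (suc K) c c∈S ⟩
    Pc A c (σ (suc K))       ≤⟨ Pc≤β·1+d ⟩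
    β * 1 + d                ≡⟨ cong (_+ d) (*-identityʳ β) ⟩
    K                        ∎)
  where
  open Guarantee A α β d approx
  open Adversary A correct α β d approx
  open ≤-Reasoning
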